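{- Let $V_1,\ldots,V_\ell$ and $W$ be subsets of a finite set $V$, with $W$ nonempty. Let $\mathcal{C}\subseteq\{V_1,\ldots,V_\ell\}$ be nonempty and write $V_{\mathcal{C}}=\bigcup_{V_i\in\mathcal{C}}V_i$. Suppose $\mathcal{C}$ is a minimal cover of $W$, i.e. $W\subseteq V_{\mathcal{C}}$ and $W\not\subseteq V_{\mathcal{C}'}$ for every proper subset $\mathcal{C}'\subsetneq\mathcal{C}$. If $W\neq V_{\mathcal{C}}$, then there exist $v_{in},v_{out}\in V_{\mathcal{C}}$ with $v_{in}\in W$ and $v_{out}\notin W$ such that there is no $V_i\in\mathcal{C}$ with $v_{in}\in V_i$ and $v_{out}\notin V_i$. -}

module Defs where

open import Data.Nat using (ℕ; zero; suc)
open import Data.Fin using (Fin; zero; suc)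
open import Data.Bool using (true; false)
open import Data.Fin.Subset using (Subset; _∪_; ⊥)
open import Data.Vec using (_∷_)

⋃[_]_ : ∀ {ℓ n} → Subset ℓ → (Fin ℓ → Subset n) → Subset n
⋃[_]_ {zero} C Vs = ⊥
⋃[_]_ {suc ℓ} (true ∷ C) Vs = Vs zero ∪ (⋃[ C ] (λ i → Vs (suc i)))
⋃[_]_ {suc ℓ} (false ∷ C) Vs = ⋃[ C ] (λ i → Vs (suc i))

module Submission where

-- Take vout ∈ V_C ∖ W and some j ∈ C with vout ∈ V_j. Dropping V_j leaves a
-- proper subfamily, which by minimality misses some vin ∈ W. Then V_j is the
-- only member of C containing vin, and it also contains vout.

open import Defs
open import Data.Nat using (ℕ; zero; suc)
open import Data.Fin using (Fin; zero; suc; _≟_)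
open import Data.Fin.Subset using (Subset; _∈_; _∉_; _⊆_; _⊂_; Nonempty; _-_)
open import Data.Fin.Subset.Properties
  using (_∈?_; ∉⊥; x∈p∪q⁺; x∈p∪q⁻; ⊆-antisym; x∈p⇒p-x⊂p; x∈p∧x≢y⇒x∈p-y)
open import Data.Fin.Properties using (¬∀⟶∃¬)
open import Data.Bool using (true; false)
open import Data.Vec using (_∷_; []; here; there)
open import Data.Product using (Σ; ∃; _×_; _,_)
open import Data.Sum using (inj₁; inj₂)
open import Relation.Nullary using (¬_; yes; no; contradiction)
open import Relation.Nullary.Decidable using (_→-dec_; decidable-stable)
open import Relation.Binary.PropositionalEquality using (_≡_; refl)

∈⋃⁻ : ∀ {ℓ n} (C : Subset ℓ) (Vs : Fin ℓ → Subset n) {x} → x ∈ ⋃[ C ] Vs →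
      ∃ λ i → i ∈ C × x ∈ Vs i
∈⋃⁻ {zero} [] Vs x∈⋃ = contradiction x∈⋃ ∉⊥
∈⋃⁻ {suc ℓ} (true ∷ C) Vs x∈⋃ with x∈p∪q⁻ (Vs zero) _ x∈⋃
... | inj₁ x∈V₀ = zero , here , x∈V₀
... | inj₂ x∈⋃ᵗ with ∈⋃⁻ C (λ i → Vs (suc i)) x∈⋃ᵗ
... | i , i∈C , x∈Vᵢ = suc i , there i∈C , x∈Vᵢ
∈⋃⁻ {suc ℓ} (false ∷ C) Vs x∈⋃ with ∈⋃⁻ C (λ i → Vs (suc i)) x∈⋃
... | i , i∈C , x∈Vᵢ = suc i , there i∈C , x∈Vᵢ

∈⋃⁺ : ∀ {ℓ n} (C : Subset ℓ) (Vs : Fin ℓ → Subset n) {x} i → i ∈ C → x ∈ Vs i →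
      x ∈ ⋃[ C ] Vs
∈⋃⁺ (true ∷ C) Vs zero here x∈V₀ = x∈p∪q⁺ (inj₁ x∈V₀)
∈⋃⁺ (true ∷ C) Vs (suc i) (there i∈C) x∈Vᵢ =
  x∈p∪q⁺ (inj₂ (∈⋃⁺ C (λ k → Vs (suc k)) i i∈C x∈Vᵢ))
∈⋃⁺ (false ∷ C) Vs (suc i) (there i∈C) x∈Vᵢ =
  ∈⋃⁺ C (λ k → Vs (suc k)) i i∈C x∈Vᵢ

∉⋃[-]⇒≡ : ∀ {ℓ n} (C : Subset ℓ) (Vs : Fin ℓ → Subset n) {x i j} →
          x ∉ ⋃[ C - j ] Vs → i ∈ C → x ∈ Vs i → i ≡ j
∉⋃[-]⇒≡ C Vs {i = i} {j} x∉⋃ i∈C x∈Vᵢ with i ≟ j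
... | yes i≡j = i≡j
... | no  i≢j = contradiction (∈⋃⁺ (C - j) Vs i (x∈p∧x≢y⇒x∈p-y i∈C i≢j) x∈Vᵢ) x∉⋃

⊈⇒∃∈∉ : ∀ {n} {p q : Subset n} → ¬ (p ⊆ q) → ∃ λ x → x ∈ p × x ∉ q
⊈⇒∃∈∉ {n} {p} {q} p⊈q
  with ¬∀⟶∃¬ n (λ x → x ∈ p → x ∈ q) (λ x → x ∈? p →-dec x ∈? q) (λ p⊆q → p⊈q (p⊆q _))
... | x , x∈p↛x∈q =
  x , decidable-stable (x ∈? p) (λ x∉p → x∈p↛x∈q (λ x∈p → contradiction x∈p x∉p))
    , (λ x∈q → x∈p↛x∈q (λ _ → x∈q))

-- Both nonemptiness hypotheses are unused: W ⊊ V_C already forces them.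
lemma14 : ∀ (n ℓ : ℕ) (Vs : Fin ℓ → Subset n) (W : Subset n) (C : Subset ℓ)
    → Nonempty W
    → Nonempty C
    → W ⊆ (⋃[ C ] Vs)
    → (∀ (C' : Subset ℓ) → C' ⊂ C → ¬ (W ⊆ (⋃[ C' ] Vs)))
    → ¬ (W ≡ (⋃[ C ] Vs))
    → Σ (Fin n) λ vin → Σ (Fin n) λ vout →
    (vin ∈ (⋃[ C ] Vs)) × (vout ∈ (⋃[ C ] Vs)) × (vin ∈ W) × (vout ∉ W)
    × ¬ (Σ (Fin ℓ) λ i → (i ∈ C) × (vin ∈ Vs i) × (vout ∉ Vs i))
lemma14 n ℓ Vs W C _ _ W⊆⋃C minimal W≢⋃C
  with ⊈⇒∃∈∉ (λ ⋃C⊆W → W≢⋃C (⊆-antisym W⊆⋃C ⋃C⊆W))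
... | vout , vout∈⋃C , vout∉W with ∈⋃⁻ C Vs vout∈⋃C
... | j , j∈C , vout∈Vⱼ with ⊈⇒∃∈∉ (minimal (C - j) (x∈p⇒p-x⊂p j∈C))
... | vin , vin∈W , vin∉⋃C-j =
  vin , vout , W⊆⋃C vin∈W , vout∈⋃C , vin∈W , vout∉W , separates
  where
  separates : ¬ (Σ (Fin ℓ) λ i → (i ∈ C) × (vin ∈ Vs i) × (vout ∉ Vs i))
  separates (i , i∈C , vin∈Vᵢ , vout∉Vᵢ) with ∉⋃[-]⇒≡ C Vs vin∉⋃C-j i∈C vin∈Vᵢ
  ... | refl = vout∉Vᵢ vout∈Vⱼ
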